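{- Let $m\geq 2$ and $n\geq 1$. Every $T\in\mathrm{rSYT}(m-1,n)$ has at least $\binom n2+1$ distinct single-row extensions.
   Context: An $m\times n$ standard Young tableau is a bijection $[m]\times[n]\to\{1,\dots,mn\}$ increasing along rows and columns; row $i$ is $\{i\}\times[n]$ and the bottom row is row $m$. A vector $x\in\mathbb{R}^k$ is increasing if $x_1<\dots<x_k$. For increasing $x\in\mathbb{R}^m$, $y\in\mathbb{R}^n$ with the numbers $x_i+y_j$ pairwise distinct, $\mathcal T(x\circ y)$ is the tableau whose $(i,j)$ entry is the rank of $x_i+y_j$ among these $mn$ numbers (rank $1$ = smallest). A tableau is realizable if it equals some $\mathcal T(x\circ y)$; $\mathrm{rSYT}(m,n)$ is the set of realizable $m\times n$ tableaux. Given $T\in\mathrm{rSYT}(m-1,n)$, a single-row extension of $T$ is a tableau $T'\in\mathrm{rSYT}(m,n)$ such that, after deleting the bottom row of $T'$, the relative order of the remaining entries is the same as that of the entries of $T$.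
   Formalization: The increasing vectors x and y that realize a tableau in rSYT have rational entries rather than real ones. -}

module Defs where

open import Data.Nat as ℕ using (ℕ; suc)
open import Data.Fin as Fin using (Fin; inject₁)
open import Data.List using (List; length; filter; cartesianProduct; allFin)
open import Data.Product using (Σ; _×_; _,_; proj₁; proj₂; ∃)
open import Data.Rational as ℚ using (ℚ)
open import Data.Rational.Properties as ℚP using ()
open import Function.Bundles using (_⇔_)
open import Relation.Binary.PropositionalEquality using (_≡_)

-- An m × n tableau: entry at (row i, column j), rows indexed top to bottom.
Tableau : ℕ → ℕ → Set
Tableau m n = Fin m → Fin n → ℕ

Increasing : {k : ℕ} → (Fin k → ℚ) → Set
Increasing {k} x = ∀ (i j : Fin k) → i Fin.< j → x i ℚ.< x j

DistinctSums : {m n : ℕ} → (Fin m → ℚ) → (Fin n → ℚ) → Set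
DistinctSums {m} {n} x y =
  ∀ (i k : Fin m) (j l : Fin n) → x i ℚ.+ y j ≡ x k ℚ.+ y l → (i ≡ k) × (j ≡ l)

rank : {m n : ℕ} → (Fin m → ℚ) → (Fin n → ℚ) → ℚ → ℕ
rank {m} {n} x y s =
  suc (length (filter (λ p → x (proj₁ p) ℚ.+ y (proj₂ p) ℚP.<? s)
                      (cartesianProduct (allFin m) (allFin n))))

𝒯 : {m n : ℕ} → (Fin m → ℚ) → (Fin n → ℚ) → Tableau m n
𝒯 x y i j = rank x y (x i ℚ.+ y j)

Realizable : {m n : ℕ} → Tableau m n → Set
Realizable {m} {n} T =
  Σ (Fin m → ℚ) λ x → Σ (Fin n → ℚ) λ y →
    Increasing x × Increasing y × DistinctSums x y ×
    (∀ (i : Fin m) (j : Fin n) → T i j ≡ 𝒯 x y i j)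

-- T' ∈ rSYT(k+1,n) is a single-row extension of T ∈ rSYT(k,n):
-- deleting the bottom row (row k+1) of T' leaves entries in the same relative order as T.
SingleRowExtension : {k n : ℕ} → Tableau k n → Tableau (suc k) n → Set
SingleRowExtension {k} {n} T T' =
  Realizable T' ×
  (∀ (i i' : Fin k) (j j' : Fin n) →
     (T' (inject₁ i) j ℕ.< T' (inject₁ i') j') ⇔ (T i j ℕ.< T i' j'))

{-# OPTIONS --safe #-}
-- Let T = 𝒯(x ∘ y). Perturbing y to y + e·2^j for a small e > 0 keeps the order of all the
-- sums x_i + y_j, but makes the n C 2 gaps y_l − y_j (j < l) pairwise distinct, because
-- distinct pairs of powers of two have distinct sums. A new bottom row t above x_k that creates
-- no tie gives a single-row extension 𝒯((x, t) ∘ y) of T, in which the new entry in column j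
-- exceeds the old last-row entry in column l exactly when t exceeds the critical value
-- x_k + y_l − y_j. As t passes the n C 2 distinct critical values, the number of such pairs
-- j < l takes every value from 0 to n C 2, and since this number can be read off the tableau,
-- the resulting n C 2 + 1 extensions are distinct.
module Submission where

open import Data.Fin as Fin using (Fin; zero; suc; toℕ; inject₁; fromℕ)
import Data.Fin.Properties as Fin
open import Data.Fin.Relation.Unary.Top using (view; ‵fromℕ; ‵inject₁)
open import Data.List using (List; []; _∷_; _++_; map; length; filter; cartesianProduct; allFin)
open import Data.List.Membership.Propositional using (_∈_; find)
open import Data.List.Membership.Propositional.Properties
  using (∈-cartesianProduct⁺; ∈-allFin; ∈-filter⁺; ∈-filter⁻)
open import Data.List.Properties
  using (filter-accept; filter-reject; filter-all; filter-none; length-++; length-map; length-tabulate)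
open import Data.List.Relation.Binary.Sublist.Propositional using (⊆-refl)
import Data.List.Relation.Binary.Sublist.Propositional.Properties as Sublist
open import Data.List.Relation.Unary.All as All using (All; []; _∷_)
import Data.List.Relation.Unary.All.Properties as All
open import Data.List.Relation.Unary.AllPairs as AllPairs using (AllPairs; []; _∷_)
import Data.List.Relation.Unary.AllPairs.Properties as AllPairs
open import Data.List.Relation.Unary.Any using (here; there)
open import Data.List.Relation.Unary.Unique.Propositional.Properties using (allFin⁺)
open import Data.Nat as ℕ using (ℕ; zero; suc; s≤s)
import Data.Nat.Properties as ℕ
open import Data.Nat.Combinatorics using (_C_; nC1≡n; nCk+nC[k+1]≡[n+1]C[k+1])
open import Data.Product using (Σ; ∃-syntax; _×_; _,_; proj₁; proj₂)
open import Data.Product.Properties using (×-≡,≡→≡; ×-≡,≡←≡)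
open import Data.Product.Relation.Binary.Lex.Strict using (×-Lex; ×-isStrictTotalOrder)
open import Data.Rational
  using (ℚ; 0ℚ; 1ℚ; _+_; _*_; _-_; -_; 1/_; _<_; _≤_; Positive; NonZero; positive; nonNegative)
open import Data.Rational.Properties
open import Data.Rational.Solver using (module +-*-Solver)
open import Data.Sum using (inj₁; inj₂)
open import Function.Base using (_∘_; case_of_)
open import Function.Bundles using (_⇔_; mk⇔; Equivalence)
import Function.Properties.Equivalence as ⇔
open import Level using (0ℓ)
open import Relation.Binary.Bundles using (DecTotalOrder)
open import Relation.Binary.Definitions using (tri<; tri≈; tri>)
open import Relation.Binary.PropositionalEquality
import Relation.Binary.Reasoning.Setoid as SetoidReasoning
open import Relation.Binary.Structures using (IsStrictTotalOrder)
open import Relation.Nullary using (¬_; yes; no; contradiction)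
open import Relation.Unary using (Pred; Decidable)

open import Algebra.Properties.Group +-0-group using (∙-cancelˡ)
open import Data.List.Extrema (DecTotalOrder.totalOrder ≤-decTotalOrder)
  using (argmin; argmin-all; f[argmin]≤f[xs])
open +-*-Solver using (solve; _:+_; _:*_; _:-_; _:=_)
open import Defs

module ⇔-Reasoning = SetoidReasoning (⇔.⇔-setoid 0ℓ)

p<q⇒0<q-p : ∀ {p q} → p < q → 0ℚ < q - p
p<q⇒0<q-p {p} {q} p<q = subst (_< q - p) (+-inverseʳ p) (+-monoˡ-< (- p) p<q)

0<q⇒p<p+q : ∀ p {q} → 0ℚ < q → p < p + q
0<q⇒p<p+q p 0<q = subst (_< p + _) (+-identityʳ p) (+-monoʳ-< p 0<q)

p+[q-p]≡q : ∀ p q → p + (q - p) ≡ q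
p+[q-p]≡q = solve 2 (λ p q → p :+ (q :- p) := q) refl

p+q<r+s⇔p+[q-s]<r : ∀ p q r s → p + q < r + s ⇔ p + (q - s) < r
p+q<r+s⇔p+[q-s]<r p q r s = mk⇔
  (λ lt → subst₂ _<_ (solve 3 (λ p q s → p :+ q :- s := p :+ (q :- s)) refl p q s)
                      (solve 2 (λ r s → r :+ s :- s := r) refl r s) (+-monoˡ-< (- s) lt))
  (λ lt → subst₂ _<_ (solve 3 (λ p q s → p :+ (q :- s) :+ s := p :+ q) refl p q s) refl (+-monoˡ-< s lt))

p+q≡r+s⇒p+[q-s]≡r : ∀ p q r s → p + q ≡ r + s → p + (q - s) ≡ r
p+q≡r+s⇒p+[q-s]≡r p q r s eq = begin
  p + (q - s)  ≡⟨ solve 3 (λ p q s → p :+ (q :- s) := p :+ q :- s) refl p q s ⟩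
  p + q - s    ≡⟨ cong (_- s) eq ⟩
  r + s - s    ≡⟨ solve 2 (λ r s → r :+ s :- s := r) refl r s ⟩
  r            ∎
  where open ≡-Reasoning

p-q≡r-s⇒p+s≡r+q : ∀ p q r s → p - q ≡ r - s → p + s ≡ r + q
p-q≡r-s⇒p+s≡r+q p q r s eq = begin
  p + s              ≡⟨ solve 3 (λ p q s → p :+ s := (p :- q) :+ (q :+ s)) refl p q s ⟩
  (p - q) + (q + s)  ≡⟨ cong (_+ (q + s)) eq ⟩
  (r - s) + (q + s)  ≡⟨ solve 3 (λ r q s → (r :- s) :+ (q :+ s) := r :+ q) refl r q s ⟩
  r + q              ∎
  where open ≡-Reasoning

count : ∀ {a p} {A : Set a} {P : Pred A p} → Decidable P → List A → ℕ
count P? xs = length (filter P? xs)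

module _ {a p} {A : Set a} {P : Pred A p} (P? : Decidable P) {x : A} {xs : List A} where

  count-accept : P x → count P? (x ∷ xs) ≡ suc (count P? xs)
  count-accept px = cong length (filter-accept P? px)

  count-reject : ¬ P x → count P? (x ∷ xs) ≡ count P? xs
  count-reject ¬px = cong length (filter-reject P? ¬px)

module _ {a p q} {A : Set a} {P : Pred A p} {Q : Pred A q} (P? : Decidable P) (Q? : Decidable Q) where

  count-mono : (∀ {x} → P x → Q x) → ∀ xs → count P? xs ℕ.≤ count Q? xs
  count-mono P⇒Q xs = Sublist.length-mono-≤ (Sublist.filter⁺ P? Q? (λ { refl → P⇒Q }) (⊆-refl {x = xs}))

  count-mono-< : (∀ {x} → P x → Q x) → ∀ {z xs} → z ∈ xs → ¬ P z → Q z →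
                 count P? xs ℕ.< count Q? xs
  count-mono-< P⇒Q {xs = x ∷ xs} (here refl) ¬px qx with P? x | Q? x
  ... | yes px | _      = contradiction px ¬px
  ... | no _   | no ¬qx = contradiction qx ¬qx
  ... | no _   | yes _  = s≤s (count-mono P⇒Q xs)
  count-mono-< P⇒Q {xs = x ∷ xs} (there z∈xs) ¬pz qz with P? x | Q? x
  ... | yes _  | yes _  = s≤s (count-mono-< P⇒Q z∈xs ¬pz qz)
  ... | yes px | no ¬qx = contradiction (P⇒Q px) ¬qx
  ... | no _   | yes _  = ℕ.m≤n⇒m≤1+n (count-mono-< P⇒Q z∈xs ¬pz qz)
  ... | no _   | no _   = count-mono-< P⇒Q z∈xs ¬pz qz

  count-cong : ∀ {xs} → All (λ x → P x ⇔ Q x) xs → count P? xs ≡ count Q? xs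
  count-cong {[]} [] = refl
  count-cong {x ∷ xs} (P⇔Q ∷ P⇔Q-rest) with P? x | Q? x
  ... | yes _  | yes _  = cong suc (count-cong P⇔Q-rest)
  ... | yes px | no ¬qx = contradiction (Equivalence.to P⇔Q px) ¬qx
  ... | no ¬px | yes qx = contradiction (Equivalence.from P⇔Q qx) ¬px
  ... | no _   | no _   = count-cong P⇔Q-rest

module _ {m n : ℕ} (x : Fin m → ℚ) (y : Fin n → ℚ) where

  private
    sum<? : ∀ s → Decidable (λ (p : Fin m × Fin n) → x (proj₁ p) + y (proj₂ p) < s)
    sum<? s p = x (proj₁ p) + y (proj₂ p) <? s

  rank-mono-< : ∀ i j {s} → x i + y j < s → rank x y (x i + y j) ℕ.< rank x y s
  rank-mono-< i j x+y<s = s≤s (count-mono-< (sum<? _) (sum<? _) (λ lt → <-trans lt x+y<s)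
    (∈-cartesianProduct⁺ (∈-allFin i) (∈-allFin j)) (<-irrefl refl) x+y<s)

  rank-cancel-< : ∀ {s s'} → rank x y s ℕ.< rank x y s' → s < s'
  rank-cancel-< {s} {s'} rank< with s <? s'
  ... | yes s<s' = s<s'
  ... | no s≮s' = contradiction rank<
    (ℕ.≤⇒≯ (s≤s (count-mono (sum<? s') (sum<? s) (λ lt → <-≤-trans lt (≮⇒≥ s≮s'))
                             (cartesianProduct (allFin m) (allFin n)))))

  𝒯-<⇔ : ∀ i i' j j' → 𝒯 x y i j ℕ.< 𝒯 x y i' j' ⇔ x i + y j < x i' + y j'
  𝒯-<⇔ i i' j j' = mk⇔ rank-cancel-< (rank-mono-< i j)

realization-<⇔ : ∀ {m n} {T : Tableau m n} (x : Fin m → ℚ) (y : Fin n → ℚ) →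
                 (∀ i j → T i j ≡ 𝒯 x y i j) →
                 ∀ i i' j j' → T i j ℕ.< T i' j' ⇔ x i + y j < x i' + y j'
realization-<⇔ x y T≗𝒯 i i' j j' =
  subst₂ (λ u v → u ℕ.< v ⇔ x i + y j < x i' + y j') (sym (T≗𝒯 i j)) (sym (T≗𝒯 i' j'))
         (𝒯-<⇔ x y i i' j j')

-- Properties of all sufficiently small positive rationals

ForSmall : (ℚ → Set) → Set
ForSmall P = ∃[ ε ] 0ℚ < ε × (∀ e → 0ℚ < e → e < ε → P e)

module _ {P : ℚ → Set} where

  forSmall-always : (∀ e → 0ℚ < e → P e) → ForSmall P
  forSmall-always P-pos = 1ℚ , positive⁻¹ 1ℚ , λ e e>0 _ → P-pos e e>0

  forSmall-witness : ForSmall P → ∃[ e ] 0ℚ < e × P e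
  forSmall-witness (ε , ε>0 , P-small) with <-dense ε>0
  ... | e , e>0 , e<ε = e , e>0 , P-small e e>0 e<ε

  forSmall-map : ∀ {Q : ℚ → Set} → (∀ e → P e → Q e) → ForSmall P → ForSmall Q
  forSmall-map P⇒Q (ε , ε>0 , P-small) = ε , ε>0 , λ e e>0 e<ε → P⇒Q e (P-small e e>0 e<ε)

  forSmall-× : ∀ {Q : ℚ → Set} → ForSmall P → ForSmall Q → ForSmall (λ e → P e × Q e)
  forSmall-× (ε₁ , ε₁>0 , P-small) (ε₂ , ε₂>0 , Q-small) with ≤-total ε₁ ε₂
  ... | inj₁ ε₁≤ε₂ = ε₁ , ε₁>0 , λ e e>0 e<ε₁ →
    P-small e e>0 e<ε₁ , Q-small e e>0 (<-≤-trans e<ε₁ ε₁≤ε₂)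
  ... | inj₂ ε₂≤ε₁ = ε₂ , ε₂>0 , λ e e>0 e<ε₂ →
    P-small e e>0 (<-≤-trans e<ε₂ ε₂≤ε₁) , Q-small e e>0 e<ε₂

forSmall-∀ : ∀ {n} {P : Fin n → ℚ → Set} →
             (∀ i → ForSmall (P i)) → ForSmall (λ e → ∀ i → P i e)
forSmall-∀ {zero} _ = forSmall-always λ _ _ ()
forSmall-∀ {suc n} P-small with forSmall-× (P-small zero) (forSmall-∀ (λ i → P-small (suc i)))
... | ε , ε>0 , both = ε , ε>0 , λ e e>0 e<ε →
  Fin.∀-cons (proj₁ (both e e>0 e<ε)) (proj₂ (both e e>0 e<ε))

forSmall-gap : ∀ c f → ForSmall (λ δ → c < f → c + δ < f)
forSmall-gap c f with c <? f
... | yes c<f = f - c , p<q⇒0<q-p c<f , λ _ _ δ<f-c _ → subst (c + _ <_) (p+[q-p]≡q c f) (+-monoʳ-< c δ<f-c)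
... | no c≮f = forSmall-always λ _ _ c<f → contradiction c<f c≮f

forSmall-<-perturb : ∀ {p q} → p < q → ∀ r s → ForSmall (λ e → p + e * r < q + e * s)
forSmall-<-perturb {p} {q} p<q r s with r ≤? s
... | yes r≤s = forSmall-always λ e e>0 →
  +-mono-<-≤ p<q (*-monoˡ-≤-nonNeg e {{nonNegative (<⇒≤ e>0)}} r≤s)
... | no r≰s = ε , ε>0 , below
  where
  d = r - s
  instance
    d-pos : Positive d
    d-pos = positive (p<q⇒0<q-p (≰⇒> r≰s))
    d-nonZero : NonZero d
    d-nonZero = pos⇒nonZero d
  ε = (q - p) * 1/ d
  ε>0 : 0ℚ < ε
  ε>0 = subst (_< ε) (*-zeroˡ (1/ d)) (*-monoˡ-<-pos (1/ d) {{1/pos⇒pos d}} (p<q⇒0<q-p p<q))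
  ε*d≡q-p : ε * d ≡ q - p
  ε*d≡q-p = trans (*-assoc (q - p) (1/ d) d) (trans (cong ((q - p) *_) (*-inverseˡ d)) (*-identityʳ (q - p)))
  below : ∀ e → 0ℚ < e → e < ε → p + e * r < q + e * s
  below e _ e<ε = subst₂ _<_
    (solve 4 (λ p e r s → p :+ e :* s :+ e :* (r :- s) := p :+ e :* r) refl p e r s)
    (solve 4 (λ p e q s → p :+ e :* s :+ (q :- p) := q :+ e :* s) refl p e q s)
    (+-monoʳ-< (p + e * s) (subst (e * d <_) ε*d≡q-p (*-monoˡ-<-pos d e<ε)))

forSmall-lex-perturb : ∀ p q r s →
  ForSmall (λ e → ×-Lex _≡_ _<_ _<_ (p , r) (q , s) → p + e * r < q + e * s)
forSmall-lex-perturb p q r s with <-cmp p q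
... | tri< p<q _ _ = forSmall-map (λ _ lt _ → lt) (forSmall-<-perturb p<q r s)
... | tri≈ _ refl _ = forSmall-always λ
  { _ _   (inj₁ p<p)       → contradiction p<p (<-irrefl refl)
  ; e e>0 (inj₂ (_ , r<s)) → +-monoʳ-< p (*-monoʳ-<-pos e {{positive e>0}} r<s) }
... | tri> p≮q p≢q _ = forSmall-always λ
  { _ _ (inj₁ p<q)       → contradiction p<q p≮q
  ; _ _ (inj₂ (p≡q , _)) → contradiction p≡q p≢q }

-- Perturbing the columns

pow₂ : ℕ → ℚ
pow₂ zero = 1ℚ
pow₂ (suc j) = pow₂ j + pow₂ j

pow₂-pos : ∀ j → 0ℚ < pow₂ j
pow₂-pos zero = positive⁻¹ 1ℚ
pow₂-pos (suc j) = <-trans (pow₂-pos j) (0<q⇒p<p+q (pow₂ j) (pow₂-pos j))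

pow₂-mono-≤ : ∀ {a b} → a ℕ.≤ b → pow₂ a ≤ pow₂ b
pow₂-mono-≤ {b = zero} ℕ.z≤n = ≤-refl
pow₂-mono-≤ {a} {suc b} a≤1+b with ℕ.m≤n⇒m<n∨m≡n a≤1+b
... | inj₁ (s≤s a≤b) = ≤-trans (pow₂-mono-≤ a≤b) (<⇒≤ (0<q⇒p<p+q (pow₂ b) (pow₂-pos b)))
... | inj₂ refl = ≤-refl

pow₂-mono-< : ∀ {a b} → a ℕ.< b → pow₂ a < pow₂ b
pow₂-mono-< {a} a<b = <-≤-trans (0<q⇒p<p+q (pow₂ a) (pow₂-pos a)) (pow₂-mono-≤ a<b)

pow₂-injective : ∀ {a b} → pow₂ a ≡ pow₂ b → a ≡ b
pow₂-injective {a} {b} eq with ℕ.<-cmp a b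
... | tri< a<b _ _ = contradiction eq (<⇒≢ (pow₂-mono-< a<b))
... | tri≈ _ a≡b _ = a≡b
... | tri> _ _ b<a = contradiction (sym eq) (<⇒≢ (pow₂-mono-< b<a))

pow₂-+-≤ : ∀ {a b l} → a ℕ.< l → b ℕ.< l → pow₂ a + pow₂ b ≤ pow₂ l
pow₂-+-≤ (s≤s a≤l) (s≤s b≤l) = +-mono-≤ (pow₂-mono-≤ a≤l) (pow₂-mono-≤ b≤l)

pow₂-sidon : ∀ {j l j' l'} → j ℕ.< l → j' ℕ.< l' →
             pow₂ l + pow₂ j' ≡ pow₂ l' + pow₂ j → l ≡ l' × j' ≡ j
pow₂-sidon {j} {l} {j'} {l'} j<l j'<l' eq with ℕ.<-cmp l l'
... | tri< l<l' _ _ = contradiction eq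
  (<⇒≢ (≤-<-trans (pow₂-+-≤ l<l' j'<l') (0<q⇒p<p+q (pow₂ l') (pow₂-pos j))))
... | tri≈ _ refl _ = refl , pow₂-injective (∙-cancelˡ (pow₂ l) (pow₂ j') (pow₂ j) eq)
... | tri> _ _ l'<l = contradiction (sym eq)
  (<⇒≢ (≤-<-trans (pow₂-+-≤ l'<l j<l) (0<q⇒p<p+q (pow₂ l) (pow₂-pos j'))))

module _ {n : ℕ} where

  perturb : ℚ → (Fin n → ℚ) → Fin n → ℚ
  perturb e y j = y j + e * pow₂ (toℕ j)

  DistinctGaps : (Fin n → ℚ) → Set
  DistinctGaps y = ∀ j l j' l' → j Fin.< l → j' Fin.< l' → y l + y j' ≡ y l' + y j → j ≡ j' × l ≡ l'

  perturb-increasing : ∀ {e y} → 0ℚ < e → Increasing y → Increasing (perturb e y)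
  perturb-increasing {e} e>0 y↑ j l j<l =
    +-mono-< (y↑ j l j<l) (*-monoʳ-<-pos e {{positive e>0}} (pow₂-mono-< j<l))

  forSmall-perturb-sums : ∀ {k} (x : Fin k → ℚ) (y : Fin n → ℚ) →
    ForSmall (λ e → ∀ i i' j j' → x i + y j < x i' + y j' → x i + perturb e y j < x i' + perturb e y j')
  forSmall-perturb-sums x y =
    forSmall-∀ λ i → forSmall-∀ λ i' → forSmall-∀ λ j → forSmall-∀ λ j' →
    forSmall-map (λ e lex⇒< lt → subst₂ _<_ (+-assoc (x i) (y j) _) (+-assoc (x i') (y j') _)
                                            (lex⇒< (inj₁ lt)))
                 (forSmall-lex-perturb (x i + y j) (x i' + y j') (pow₂ (toℕ j)) (pow₂ (toℕ j')))

  -- Ties y l + y j' = y l' + y j are broken lexicographically by the weight sums, which pow₂-sidon keeps apart.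
  forSmall-perturb-gaps : (y : Fin n → ℚ) → ForSmall (λ e → DistinctGaps (perturb e y))
  forSmall-perturb-gaps y = forSmall-map distinct
    (forSmall-∀ λ j → forSmall-∀ λ l → forSmall-∀ λ j' → forSmall-∀ λ l' →
     forSmall-lex-perturb (y l + y j') (y l' + y j) (w l + w j') (w l' + w j))
    where
    w : Fin n → ℚ
    w j = pow₂ (toℕ j)
    compare = IsStrictTotalOrder.compare (×-isStrictTotalOrder <-isStrictTotalOrder <-isStrictTotalOrder)
    regroup : ∀ e j l → perturb e y l + perturb e y j ≡ (y l + y j) + e * (w l + w j)
    regroup e j l = solve 5 (λ a b c u v → (a :+ c :* u) :+ (b :+ c :* v) := (a :+ b) :+ c :* (u :+ v))
                            refl (y l) (y j) e (w l) (w j)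
    distinct : ∀ e → (∀ j l j' l' → ×-Lex _≡_ _<_ _<_ (y l + y j' , w l + w j') (y l' + y j , w l' + w j) →
                                    (y l + y j') + e * (w l + w j') < (y l' + y j) + e * (w l' + w j)) →
               DistinctGaps (perturb e y)
    distinct e lex⇒< j l j' l' j<l j'<l' eq
      with compare (y l + y j' , w l + w j') (y l' + y j , w l' + w j)
    ... | tri< lt _ _ = contradiction (trans (sym (regroup e j' l)) (trans eq (regroup e j l')))
                                      (<⇒≢ (lex⇒< j l j' l' lt))
    ... | tri> _ _ gt = contradiction (trans (sym (regroup e j l')) (trans (sym eq) (regroup e j' l)))
                                      (<⇒≢ (lex⇒< j' l' j l gt))
    ... | tri≈ _ (_ , w-eq) _ with pow₂-sidon j<l j'<l' w-eq
    ...   | l≡l' , j'≡j = Fin.toℕ-injective (sym j'≡j) , Fin.toℕ-injective l≡l'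

module _ {I : Set} {f g : I → ℚ} (f-injective : ∀ {p q} → f p ≡ f q → p ≡ q)
         (f<⇒g< : ∀ {p q} → f p < f q → g p < g q) where

  preserves⇒reflects-< : ∀ {p q} → g p < g q → f p < f q
  preserves⇒reflects-< {p} {q} gp<gq with <-cmp (f p) (f q)
  ... | tri< fp<fq _ _ = fp<fq
  ... | tri≈ _ fp≡fq _ rewrite f-injective fp≡fq = contradiction gp<gq (<-irrefl refl)
  ... | tri> _ _ fq<fp = contradiction (f<⇒g< fq<fp) (<-asym gp<gq)

  preserves⇒injective : ∀ {p q} → g p ≡ g q → p ≡ q
  preserves⇒injective {p} {q} gp≡gq with <-cmp (f p) (f q)
  ... | tri< fp<fq _ _ = contradiction gp≡gq (<⇒≢ (f<⇒g< fp<fq))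
  ... | tri≈ _ fp≡fq _ = f-injective fp≡fq
  ... | tri> _ _ fq<fp = contradiction (sym gp≡gq) (<⇒≢ (f<⇒g< fq<fp))

module _ {k n : ℕ} (x : Fin k → ℚ) {y y' : Fin n → ℚ} (x+y-distinct : DistinctSums x y)
         (preserves : ∀ i i' j j' → x i + y j < x i' + y j' → x i + y' j < x i' + y' j') where

  private
    sum sum' : Fin k × Fin n → ℚ
    sum (i , j) = x i + y j
    sum' (i , j) = x i + y' j

    sum-injective : ∀ {p q} → sum p ≡ sum q → p ≡ q
    sum-injective {i , j} {i' , j'} eq = ×-≡,≡→≡ (x+y-distinct i i' j j' eq)

    sum'-preserves : ∀ {p q} → sum p < sum q → sum' p < sum' q
    sum'-preserves {i , j} {i' , j'} = preserves i i' j j'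

  sums-<⇔ : ∀ i i' j j' → x i + y j < x i' + y j' ⇔ x i + y' j < x i' + y' j'
  sums-<⇔ i i' j j' =
    mk⇔ (preserves i i' j j') (preserves⇒reflects-< sum-injective sum'-preserves {i , j} {i' , j'})

  sums-distinct : DistinctSums x y'
  sums-distinct i i' j j' eq =
    ×-≡,≡←≡ (preserves⇒injective sum-injective sum'-preserves {i , j} {i' , j'} eq)

perturbation : ∀ {k n} (x : Fin k → ℚ) (y : Fin n → ℚ) → Increasing y → DistinctSums x y →
  ∃[ y' ] Increasing y' × DistinctSums x y' × DistinctGaps y' ×
          (∀ i i' j j' → x i + y j < x i' + y j' ⇔ x i + y' j < x i' + y' j')
perturbation x y y↑ x+y-distinct =
  case forSmall-witness (forSmall-× (forSmall-perturb-sums x y) (forSmall-perturb-gaps y)) of λ where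
    (e , e>0 , preserves , gaps) →
      perturb e y , perturb-increasing e>0 y↑ , sums-distinct x x+y-distinct preserves , gaps ,
      sums-<⇔ x x+y-distinct preserves

module _ {k : ℕ} {x : Fin k → ℚ} (x↑ : Increasing x) where

  increasing-injective : ∀ {i j} → x i ≡ x j → i ≡ j
  increasing-injective {i} {j} eq with Fin.<-cmp i j
  ... | tri< i<j _ _ = contradiction eq (<⇒≢ (x↑ i j i<j))
  ... | tri≈ _ i≡j _ = i≡j
  ... | tri> _ _ j<i = contradiction (sym eq) (<⇒≢ (x↑ j i j<i))

  increasing-mono-≤ : ∀ {i j} → i Fin.≤ j → x i ≤ x j
  increasing-mono-≤ {i} {j} i≤j with ℕ.m≤n⇒m<n∨m≡n i≤j
  ... | inj₁ i<j = <⇒≤ (x↑ i j i<j)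
  ... | inj₂ i≡j rewrite Fin.toℕ-injective i≡j = ≤-refl

module _ {A : Set} where

  _∷ʳ_ : ∀ {k} → (Fin k → A) → A → Fin (suc k) → A
  _∷ʳ_ {zero} x t _ = t
  _∷ʳ_ {suc k} x t zero = x zero
  _∷ʳ_ {suc k} x t (suc i) = ((λ i → x (suc i)) ∷ʳ t) i

  ∷ʳ-inject₁ : ∀ {k} (x : Fin k → A) t i → (x ∷ʳ t) (inject₁ i) ≡ x i
  ∷ʳ-inject₁ {suc k} x t zero = refl
  ∷ʳ-inject₁ {suc k} x t (suc i) = ∷ʳ-inject₁ (λ i → x (suc i)) t i

  ∷ʳ-fromℕ : ∀ {k} (x : Fin k → A) t → (x ∷ʳ t) (fromℕ k) ≡ t
  ∷ʳ-fromℕ {zero} x t = refl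
  ∷ʳ-fromℕ {suc k} x t = ∷ʳ-fromℕ (λ i → x (suc i)) t

module _ {k : ℕ} {x : Fin k → ℚ} {t : ℚ} where

  ∷ʳ-increasing : Increasing x → (∀ i → x i < t) → Increasing (x ∷ʳ t)
  ∷ʳ-increasing x↑ x<t i j i<j with view i | view j
  ... | ‵fromℕ | _ = contradiction i<j (ℕ.≤⇒≯ (Fin.≤fromℕ j))
  ... | ‵inject₁ a | ‵fromℕ rewrite ∷ʳ-inject₁ x t a | ∷ʳ-fromℕ x t = x<t a
  ... | ‵inject₁ a | ‵inject₁ b rewrite ∷ʳ-inject₁ x t a | ∷ʳ-inject₁ x t b =
    x↑ a b (subst₂ ℕ._<_ (Fin.toℕ-inject₁ a) (Fin.toℕ-inject₁ b) i<j)

  ∷ʳ-distinctSums : ∀ {n} {y : Fin n → ℚ} → Increasing y → DistinctSums x y →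
                    (∀ i j l → x i + y j ≢ t + y l) → DistinctSums (x ∷ʳ t) y
  ∷ʳ-distinctSums {y = y} y↑ distinct t-avoids i i' j j' eq with view i | view i'
  ... | ‵inject₁ a | ‵inject₁ b
    with distinct a b j j' (subst₂ (λ u v → u + y j ≡ v + y j')
                                   (∷ʳ-inject₁ x t a) (∷ʳ-inject₁ x t b) eq)
  ...   | refl , j≡j' = refl , j≡j'
  ∷ʳ-distinctSums {y = y} y↑ distinct t-avoids i i' j j' eq | ‵inject₁ a | ‵fromℕ =
    contradiction (subst₂ (λ u v → u + y j ≡ v + y j') (∷ʳ-inject₁ x t a) (∷ʳ-fromℕ x t) eq)
                  (t-avoids a j j')
  ∷ʳ-distinctSums {y = y} y↑ distinct t-avoids i i' j j' eq | ‵fromℕ | ‵inject₁ b =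
    contradiction (subst₂ (λ u v → v + y j' ≡ u + y j) (∷ʳ-fromℕ x t) (∷ʳ-inject₁ x t b) (sym eq))
                  (t-avoids b j' j)
  ∷ʳ-distinctSums {y = y} y↑ distinct t-avoids i i' j j' eq | ‵fromℕ | ‵fromℕ =
    refl , increasing-injective y↑ (∙-cancelˡ ((x ∷ʳ t) (fromℕ k)) (y j) (y j') eq)

-- Thresholds among finitely many distinct values

module _ {A : Set} (f : A → ℚ) where

  private
    f≤? : ∀ c → Decidable (λ a → f a ≤ c)
    f≤? c a = f a ≤? c

  least-above : ∀ c {xs a₀} → a₀ ∈ xs → c < f a₀ →
                ∃[ m ] (m ∈ xs × c < f m) × (∀ {b} → b ∈ xs → c < f b → f m ≤ f b)
  least-above c {xs} {a₀} a₀∈xs c<fa₀ =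
    m , argmin-all f (a₀∈xs , c<fa₀) (All.tabulate (∈-filter⁻ above?)) ,
    λ b∈xs c<fb → All.lookup (f[argmin]≤f[xs] a₀ (filter above? xs)) (∈-filter⁺ above? b∈xs c<fb)
    where
    above? : Decidable (λ a → c < f a)
    above? a = c <? f a
    m = argmin f a₀ (filter above? xs)

  private
    no-value-between : ∀ {c m xs} → c < f m → (∀ {b} → b ∈ xs → c < f b → f m ≤ f b) →
                       ∀ {b} → b ∈ xs → f b ≢ f m → (f b ≤ f m ⇔ f b ≤ c)
    no-value-between c<fm least b∈xs fb≢fm = mk⇔
      (λ fb≤fm → ≮⇒≥ (λ c<fb → fb≢fm (≤-antisym fb≤fm (least b∈xs c<fb))))
      (λ fb≤c → <⇒≤ (≤-<-trans fb≤c c<fm))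

  count-≤-least-above : ∀ {c m xs} → AllPairs (λ a b → f a ≢ f b) xs → m ∈ xs → c < f m →
                        (∀ {b} → b ∈ xs → c < f b → f m ≤ f b) →
                        count (f≤? (f m)) xs ≡ suc (count (f≤? c) xs)
  count-≤-least-above {c} {m} {a ∷ xs} (fa≢ ∷ _) (here refl) c<fm least = begin
    count (f≤? (f a)) (a ∷ xs)    ≡⟨ count-accept (f≤? (f a)) ≤-refl ⟩
    suc (count (f≤? (f a)) xs)    ≡⟨ cong suc (count-cong (f≤? (f a)) (f≤? c) (All.tabulate λ b∈xs →
                                       no-value-between c<fm (least ∘ there) b∈xs
                                                        (≢-sym (All.lookup fa≢ b∈xs)))) ⟩
    suc (count (f≤? c) xs)        ≡⟨ cong suc (count-reject (f≤? c) (λ fa≤c →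
                                       <-irrefl refl (<-≤-trans c<fm fa≤c))) ⟨
    suc (count (f≤? c) (a ∷ xs))  ∎
    where open ≡-Reasoning
  count-≤-least-above {c} {m} {a ∷ xs} (fa≢ ∷ distinct) (there m∈xs) c<fm least with f a ≤? c
  ... | yes fa≤c = begin
    count (f≤? (f m)) (a ∷ xs)    ≡⟨ count-accept (f≤? (f m)) (Equivalence.from between fa≤c) ⟩
    suc (count (f≤? (f m)) xs)    ≡⟨ cong suc (count-≤-least-above distinct m∈xs c<fm (least ∘ there)) ⟩
    suc (suc (count (f≤? c) xs))  ≡⟨ cong suc (count-accept (f≤? c) fa≤c) ⟨
    suc (count (f≤? c) (a ∷ xs))  ∎
    where
    open ≡-Reasoning
    between = no-value-between c<fm least (here refl) (All.lookup fa≢ m∈xs)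
  ... | no fa≰c = begin
    count (f≤? (f m)) (a ∷ xs)    ≡⟨ count-reject (f≤? (f m)) (fa≰c ∘ Equivalence.to between) ⟩
    count (f≤? (f m)) xs          ≡⟨ count-≤-least-above distinct m∈xs c<fm (least ∘ there) ⟩
    suc (count (f≤? c) xs)        ≡⟨ cong suc (count-reject (f≤? c) fa≰c) ⟨
    suc (count (f≤? c) (a ∷ xs))  ∎
    where
    open ≡-Reasoning
    between = no-value-between c<fm least (here refl) (All.lookup fa≢ m∈xs)

  threshold-with-count : ∀ {lo xs} → AllPairs (λ a b → f a ≢ f b) xs → All (λ a → lo < f a) xs →
                         ∀ a → a ℕ.≤ length xs → ∃[ c ] lo ≤ c × count (f≤? c) xs ≡ a
  threshold-with-count {lo} _ lo<f zero _ =
    lo , ≤-refl ,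
    cong length (filter-none (f≤? lo)
                             (All.map (λ lo<fa fa≤lo → <-irrefl refl (<-≤-trans lo<fa fa≤lo)) lo<f))
  threshold-with-count {lo} {xs} distinct lo<f (suc a) a<len
    with threshold-with-count distinct lo<f a (ℕ.<⇒≤ a<len)
  ... | c , lo≤c , count≡a
    with find (All.¬All⇒Any¬ (f≤? c) xs (λ all≤c →
           ℕ.<⇒≢ a<len (trans (sym count≡a) (cong length (filter-all (f≤? c) all≤c)))))
  ... | b , b∈xs , fb≰c with least-above c b∈xs (≰⇒> fb≰c)
  ... | m , (m∈xs , c<fm) , least =
    f m , ≤-trans lo≤c (<⇒≤ c<fm) ,
    trans (count-≤-least-above distinct m∈xs c<fm least) (cong suc count≡a)

module _ {c t : ℚ} (c<t : c < t) {f : ℚ} (t<f-if-c<f : c < f → t < f) where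

  gap-position : f < t ⇔ f ≤ c
  gap-position = mk⇔ (λ f<t → ≮⇒≥ (λ c<f → <-asym f<t (t<f-if-c<f c<f)))
                     (λ f≤c → ≤-<-trans f≤c c<t)

  gap-avoids : f ≢ t
  gap-avoids refl = <-irrefl refl (t<f-if-c<f c<t)

IncreasingPair : ℕ → Set
IncreasingPair n = Σ (Fin n × Fin n) (λ p → proj₁ p Fin.< proj₂ p)

module _ {n : ℕ} where

  zeroPair : Fin n → IncreasingPair (suc n)
  zeroPair l = (zero , suc l) , s≤s ℕ.z≤n

  sucPair : IncreasingPair n → IncreasingPair (suc n)
  sucPair ((j , l) , j<l) = (suc j , suc l) , s≤s j<l

increasingPairs : ∀ n → List (IncreasingPair n)
increasingPairs zero = []
increasingPairs (suc n) = map zeroPair (allFin n) ++ map sucPair (increasingPairs n)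

length-increasingPairs : ∀ n → length (increasingPairs n) ≡ n C 2
length-increasingPairs zero = refl
length-increasingPairs (suc n) = begin
  length (map zeroPair (allFin n) ++ map sucPair (increasingPairs n))
    ≡⟨ length-++ (map zeroPair (allFin n)) ⟩
  length (map zeroPair (allFin n)) ℕ.+ length (map sucPair (increasingPairs n))
    ≡⟨ cong₂ ℕ._+_ (trans (length-map zeroPair (allFin n)) (length-tabulate (λ l → l)))
                   (trans (length-map sucPair (increasingPairs n)) (length-increasingPairs n)) ⟩
  n ℕ.+ n C 2
    ≡⟨ cong (ℕ._+ n C 2) (nC1≡n n) ⟨
  n C 1 ℕ.+ n C 2
    ≡⟨ nCk+nC[k+1]≡[n+1]C[k+1] n 1 ⟩
  suc n C 2 ∎
  where open ≡-Reasoning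

increasingPairs-distinct : ∀ n → AllPairs (λ p q → proj₁ p ≢ proj₁ q) (increasingPairs n)
increasingPairs-distinct zero = []
increasingPairs-distinct (suc n) = AllPairs.++⁺
  (AllPairs.map⁺ (AllPairs.map (λ l≢l' eq → l≢l' (Fin.suc-injective (cong proj₂ eq))) (allFin⁺ n)))
  (AllPairs.map⁺ (AllPairs.map (λ p≢q eq → p≢q (×-≡,≡→≡ (Fin.suc-injective (cong proj₁ eq) ,
                                                         Fin.suc-injective (cong proj₂ eq))))
                               (increasingPairs-distinct n)))
  (All.map⁺ (All.universal (λ _ → All.map⁺ (All.universal (λ _ eq → Fin.0≢1+n (cong proj₁ eq)) _)) _))

crossings : ∀ {m n} → Fin m → Fin m → Tableau m n → ℕ
crossings {n = n} r r' T =
  count (λ p → T r (proj₂ (proj₁ p)) ℕ.<? T r' (proj₁ (proj₁ p))) (increasingPairs n)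

crossings-cong : ∀ {m n} (r r' : Fin m) {T T' : Tableau m n} → (∀ i j → T i j ≡ T' i j) →
                 crossings r r' T ≡ crossings r r' T'
crossings-cong {n = n} r r' T≗T' = count-cong _ _ (All.universal (λ p →
  mk⇔ (subst₂ ℕ._<_ (T≗T' r _) (T≗T' r' _)) (subst₂ ℕ._<_ (sym (T≗T' r _)) (sym (T≗T' r' _))))
  (increasingPairs n))

-- The new row

module NewRow {k n : ℕ} (x : Fin (suc k) → ℚ) (y : Fin n → ℚ) (x↑ : Increasing x) (y↑ : Increasing y)
              (distinct : DistinctSums x y) (gaps : DistinctGaps y) where

  xₖ : ℚ
  xₖ = x (fromℕ k)

  -- The value of t at which t + y j overtakes xₖ + y l.
  critical : IncreasingPair n → ℚ
  critical ((j , l) , _) = xₖ + (y l - y j)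

  Generic : ℚ → Set
  Generic t = xₖ < t × (∀ i j l → x i + y j ≢ t + y l)

  generic-above : ∀ {c} → xₖ ≤ c → ∃[ t ] Generic t × (∀ p → critical p < t ⇔ critical p ≤ c)
  generic-above {c} xₖ≤c =
    case forSmall-witness (forSmall-∀ λ i → forSmall-∀ λ j → forSmall-∀ λ l →
                           forSmall-gap c (x i + (y j - y l))) of λ where
      (δ , δ>0 , clear) →
        let c<t = 0<q⇒p<p+q c δ>0 in
        c + δ ,
        (≤-<-trans xₖ≤c c<t ,
         λ i j l → gap-avoids c<t (clear i j l) ∘ p+q≡r+s⇒p+[q-s]≡r (x i) (y j) (c + δ) (y l)) ,
        λ p → gap-position c<t (clear (fromℕ k) _ _)

  critical-injective : ∀ {p q} → critical p ≡ critical q → proj₁ p ≡ proj₁ q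
  critical-injective {(j , l) , j<l} {(j' , l') , j'<l'} eq = ×-≡,≡→≡ (gaps j l j' l' j<l j'<l'
    (p-q≡r-s⇒p+s≡r+q (y l) (y j) (y l') (y j') (∙-cancelˡ xₖ (y l - y j) (y l' - y j') eq)))

  criticals-distinct : AllPairs (λ p q → critical p ≢ critical q) (increasingPairs n)
  criticals-distinct =
    AllPairs.map (λ {p} {q} p≢q → p≢q ∘ critical-injective {p} {q}) (increasingPairs-distinct n)

  criticals-above : All (λ p → xₖ < critical p) (increasingPairs n)
  criticals-above =
    All.universal (λ ((j , l) , j<l) → 0<q⇒p<p+q xₖ (p<q⇒0<q-p (y↑ j l j<l))) (increasingPairs n)

  generic-with-count : ∀ a → a ℕ.≤ n C 2 →
                       ∃[ t ] Generic t × count (λ p → critical p <? t) (increasingPairs n) ≡ a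
  generic-with-count a a≤ =
    let c , xₖ≤c , count≤c≡a = threshold-with-count critical criticals-distinct criticals-above a
                                 (subst (a ℕ.≤_) (sym (length-increasingPairs n)) a≤)
        t , generic , position = generic-above xₖ≤c
    in t , generic , trans (count-cong (λ p → critical p <? t) (λ p → critical p ≤? c)
                                       (All.universal position (increasingPairs n)))
                           count≤c≡a

  extend : ℚ → Tableau (suc (suc k)) n
  extend t = 𝒯 (x ∷ʳ t) y

  extend-realizable : ∀ {t} → Generic t → Realizable (extend t)
  extend-realizable {t} (xₖ<t , avoids) =
    x ∷ʳ t , y , ∷ʳ-increasing x↑ (λ i → ≤-<-trans (increasing-mono-≤ x↑ (Fin.≤fromℕ i)) xₖ<t) , y↑ ,
    ∷ʳ-distinctSums y↑ distinct avoids , λ _ _ → refl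

  extend-top-<⇔ : ∀ t i i' j j' →
                  extend t (inject₁ i) j ℕ.< extend t (inject₁ i') j' ⇔ x i + y j < x i' + y j'
  extend-top-<⇔ t i i' j j' =
    subst₂ (λ u v → extend t (inject₁ i) j ℕ.< extend t (inject₁ i') j' ⇔ u + y j < v + y j')
           (∷ʳ-inject₁ x t i) (∷ʳ-inject₁ x t i') (𝒯-<⇔ (x ∷ʳ t) y (inject₁ i) (inject₁ i') j j')

  crossings-extend : ∀ t → crossings (inject₁ (fromℕ k)) (fromℕ (suc k)) (extend t) ≡
                           count (λ p → critical p <? t) (increasingPairs n)
  crossings-extend t = count-cong _ (λ p → critical p <? t) (All.universal crossing⇔ (increasingPairs n))
    where
    crossing⇔ : ∀ p → extend t (inject₁ (fromℕ k)) (proj₂ (proj₁ p)) ℕ.<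
                      extend t (fromℕ (suc k)) (proj₁ (proj₁ p)) ⇔ critical p < t
    crossing⇔ ((j , l) , _) = ⇔.trans
      (subst₂ (λ u v → extend t (inject₁ (fromℕ k)) l ℕ.< extend t (fromℕ (suc k)) j ⇔
                       u + y l < v + y j)
              (∷ʳ-inject₁ x t (fromℕ k)) (∷ʳ-fromℕ x t)
              (𝒯-<⇔ (x ∷ʳ t) y (inject₁ (fromℕ k)) (fromℕ (suc k)) l j))
      (p+q<r+s⇔p+[q-s]<r xₖ (y l) t (y j))

  extensions : Σ (Fin (n C 2 ℕ.+ 1) → Tableau (suc (suc k)) n) λ E →
    (∀ a → Realizable (E a) ×
           (∀ i i' j j' → E a (inject₁ i) j ℕ.< E a (inject₁ i') j' ⇔ x i + y j < x i' + y j')) ×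
    (∀ a b → (∀ i j → E a i j ≡ E b i j) → a ≡ b)
  extensions = E , (λ a → extend-realizable (generic a) , extend-top-<⇔ (t a)) , E-injective
    where
    bound : (a : Fin (n C 2 ℕ.+ 1)) → toℕ a ℕ.≤ n C 2
    bound a = ℕ.≤-pred (subst (toℕ a ℕ.<_) (ℕ.+-comm (n C 2) 1) (Fin.toℕ<n a))

    t : Fin (n C 2 ℕ.+ 1) → ℚ
    t a = proj₁ (generic-with-count (toℕ a) (bound a))

    generic : ∀ a → Generic (t a)
    generic a = proj₁ (proj₂ (generic-with-count (toℕ a) (bound a)))

    E : Fin (n C 2 ℕ.+ 1) → Tableau (suc (suc k)) n
    E a = extend (t a)

    old new : Fin (suc (suc k))
    old = inject₁ (fromℕ k)
    new = fromℕ (suc k)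

    E-crossings : ∀ a → crossings old new (E a) ≡ toℕ a
    E-crossings a = trans (crossings-extend (t a)) (proj₂ (proj₂ (generic-with-count (toℕ a) (bound a))))

    E-injective : ∀ a b → (∀ i j → E a i j ≡ E b i j) → a ≡ b
    E-injective a b E≗ = Fin.toℕ-injective (begin
      toℕ a                    ≡⟨ E-crossings a ⟨
      crossings old new (E a)  ≡⟨ crossings-cong old new E≗ ⟩
      crossings old new (E b)  ≡⟨ E-crossings b ⟩
      toℕ b                    ∎)
      where open ≡-Reasoning

lemma2p9 : (k n : ℕ) → 1 ℕ.≤ k → 1 ℕ.≤ n → (T : Tableau k n) → Realizable T →
    Σ (Fin (n C 2 ℕ.+ 1) → Tableau (suc k) n) λ E →
    (∀ (a : Fin (n C 2 ℕ.+ 1)) → SingleRowExtension T (E a)) ×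
    (∀ (a b : Fin (n C 2 ℕ.+ 1)) → (∀ i j → E a i j ≡ E b i j) → a ≡ b)
lemma2p9 (suc k) n _ _ T (x , y , x↑ , y↑ , x+y-distinct , T≗𝒯) =
  case perturbation x y y↑ x+y-distinct of λ where
    (y' , y'↑ , x+y'-distinct , y'-gaps , same-order) →
      case NewRow.extensions x y' x↑ y'↑ x+y'-distinct y'-gaps of λ where
        (E , E-extends , E-injective) →
          E , (λ a → proj₁ (E-extends a) , λ i i' j j' → begin
                 E a (inject₁ i) j ℕ.< E a (inject₁ i') j'  ≈⟨ proj₂ (E-extends a) i i' j j' ⟩
                 x i + y' j < x i' + y' j'                 ≈⟨ same-order i i' j j' ⟨
                 x i + y j < x i' + y j'                   ≈⟨ realization-<⇔ x y T≗𝒯 i i' j j' ⟨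
                 T i j ℕ.< T i' j'                         ∎) ,
          E-injective
  where open ⇔-Reasoning
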